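{- Let $q\ge5$ be an odd prime power. In $\mathrm{AG}(2,q)$ there exists a minimal blocking set of size $k$ for every integer $k$ with $2q-1\le k\le 3q-4$.
   Context: $\mathrm{AG}(2,q)$ is the affine plane of order $q$. A blocking set of $\mathrm{AG}(2,q)$ is a set of points meeting every line of $\mathrm{AG}(2,q)$ (it may contain lines); it is minimal if no proper subset is a blocking set. -}

module Defs where

open import Level using (0ℓ)
open import Data.Nat using (ℕ; suc; _^_)
open import Data.Nat.Primality using (Prime)
open import Data.Fin using (Fin)
open import Data.Product using (Σ; ∃; _×_; _,_)
open import Data.List using (List)
open import Data.List.Membership.Propositional using (_∈_)
open import Relation.Binary.PropositionalEquality using (_≡_)
open import Relation.Nullary using (¬_)
import Algebra.Structures
open import Function.Bundles using (_⤖_)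

IsPrimePower : ℕ → Set
IsPrimePower q = Σ ℕ λ p → Σ ℕ λ e → Prime p × q ≡ p ^ suc e

record FiniteField (q : ℕ) : Set₁ where
  field
    Carrier : Set
    _+_ _*_ : Carrier → Carrier → Carrier
    -_      : Carrier → Carrier
    0# 1#   : Carrier
    isCommutativeRing : Algebra.Structures.IsCommutativeRing {A = Carrier} _≡_ _+_ _*_ -_ 0# 1#
    0≢1     : ¬ (0# ≡ 1#)
    inverse : ∀ x → ¬ (x ≡ 0#) → Σ Carrier λ y → x * y ≡ 1#
    size    : Fin q ⤖ Carrier

module AG2 {q : ℕ} (F : FiniteField q) where
  open FiniteField F

  Point : Set
  Point = Carrier × Carrier

  OnLine : Carrier → Carrier → Carrier → Point → Set
  OnLine a b c (x , y) = (a * x) + (b * y) ≡ c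

  -- (a , b) ≠ (0 , 0): the equation a X + b Y = c defines a line;
  -- every line of AG(2,q) arises this way
  IsLineEq : Carrier → Carrier → Set
  IsLineEq a b = ¬ ((a ≡ 0#) × (b ≡ 0#))

  Blocking : List Point → Set
  Blocking B = ∀ a b c → IsLineEq a b → Σ Point λ p → p ∈ B × OnLine a b c p

  -- no proper subset is blocking: every blocking subset contains all of B
  MinimalBlocking : List Point → Set
  MinimalBlocking B =
    Blocking B ×
    (∀ (S : List Point) → (∀ p → p ∈ S → p ∈ B) → Blocking S → ∀ p → p ∈ B → p ∈ S)

{-# OPTIONS --safe #-}
-- Split the q - 2 elements of F ∖ {0, 1} into Y₀ ≠ ∅ and Y₁, and let
--   B = {(-1, 0)} ∪ {(y/(1-y), 0) : y ∈ Y₀} ∪ {(x, 1) : x ≠ 0} ∪ {(0, y) : y ∈ Y₀} ∪ {(y, y) : y ∈ Y₁},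
-- a set of 2q - 2 + |Y₀| points; as |Y₀| runs over 1, …, q - 2 this gives every size 2q - 1, …, 3q - 4.
-- B is blocking: a line Y = y meets B in (0, y) or (y, y) (or in (-1, 0), (1, 1)), and any other line
-- either meets Y = 1 outside (0, 1) or is a line X + cY = c through (0, 1); the latter is X = 0,
-- passes through (-1, 0), or meets Y = 0 and X = Y in (c, 0) and (y, y) with c = y/(1-y), and exactly
-- one of those two points is in B.
-- B is minimal since each of its points lies on a tangent, a line meeting B only there: Y = y for (0, y)
-- and (y, y), a line through (0, 1) for the points on Y = 0, a line through (0, 0) for (x, 1) with
-- x ≠ 1, and for (1, 1) either X = Y (if Y₁ = ∅) or the line through (1, 1) and (ys/(1-ys), 0) for a
-- suitable "pivot" ys ∈ Y₁.
module Submission where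

open import Level using (0ℓ)
open import Data.Nat as ℕ using (ℕ; zero; suc; _≤_; _<_; _∸_)
open import Data.Nat.Divisibility using (_∣_)
import Data.Nat.Properties as ℕ
open import Data.Nat.Solver using (module +-*-Solver)
open import Data.Fin.Properties using (inj⇒≟)
open import Data.Product using (Σ; ∃; _×_; _,_; proj₁; proj₂)
open import Data.Sum using (_⊎_; inj₁; inj₂; swap)
open import Data.List using (List; []; _∷_; _++_; length; map; filter; take; drop; tabulate)
import Data.List.Properties as List
open import Data.List.Membership.Propositional using (_∈_; _∉_)
open import Data.List.Membership.Propositional.Properties
  using (∈-filter⁺; ∈-filter⁻; ∈-map⁺; ∈-map⁻; ∈-++⁺ˡ; ∈-++⁺ʳ; ∈-++⁻; ∈-tabulate⁺)
open import Data.List.Relation.Unary.Any using (here; there)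
open import Data.List.Relation.Unary.All as All using (All; []; _∷_)
import Data.List.Relation.Unary.All.Properties as All
open import Data.List.Relation.Unary.AllPairs using ([]; _∷_)
open import Data.List.Relation.Unary.Unique.Propositional using (Unique)
import Data.List.Relation.Unary.Unique.Propositional.Properties as Unique
open import Data.List.Relation.Binary.Disjoint.Propositional using (Disjoint)
open import Function using (_∘_)
open import Function.Bundles using (Bijection)
open import Function.Properties.Bijection using (⤖⇒↔)
open import Function.Properties.Inverse using (↔-sym; ↔⇒↣)
open import Relation.Binary.Definitions using (DecidableEquality)
open import Relation.Binary.PropositionalEquality
open import Relation.Nullary using (¬_; yes; no; ¬?; contradiction)
open import Algebra.Bundles using (CommutativeRing)
import Algebra.Properties.Ring as RingProperties
import Algebra.Solver.Ring.NaturalCoefficients.Default as NaturalCoefficientSolver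

open import Defs

module _ {A : Set} where

  ∃∈-nonempty : ∀ (xs : List A) → 0 < length xs → ∃ (_∈ xs)
  ∃∈-nonempty (x ∷ _) _ = x , here refl

  Unique-++⇒Disjoint : ∀ (xs : List A) {ys} → Unique (xs ++ ys) → Disjoint xs ys
  Unique-++⇒Disjoint (x ∷ xs) (x∉ ∷ _) (here refl , x∈ys) = All.lookup x∉ (∈-++⁺ʳ xs x∈ys) refl
  Unique-++⇒Disjoint (x ∷ xs) (_ ∷ u) (there v∈xs , v∈ys) = Unique-++⇒Disjoint xs u (v∈xs , v∈ys)

  map⁺-injectiveOn : ∀ {B : Set} {P : A → Set} {f : A → B} {xs} →
    (∀ {x y} → P x → P y → f x ≡ f y → x ≡ y) → All P xs → Unique xs → Unique (map f xs)
  map⁺-injectiveOn inj [] [] = []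
  map⁺-injectiveOn inj (px ∷ pxs) (x∉ ∷ u) =
    All.map⁺ (All.zipWith (λ (py , x≢y) → x≢y ∘ inj px py) (pxs , x∉)) ∷ map⁺-injectiveOn inj pxs u

module Removal {A : Set} (_≟_ : DecidableEquality A) where

  infixl 6 _∖_
  _∖_ : List A → A → List A
  xs ∖ a = filter (λ x → ¬? (x ≟ a)) xs

  ∈-∖⁺ : ∀ {a x xs} → x ∈ xs → x ≢ a → x ∈ xs ∖ a
  ∈-∖⁺ = ∈-filter⁺ (λ x → ¬? (x ≟ _))

  ∈-∖⁻ : ∀ {a x} xs → x ∈ xs ∖ a → x ∈ xs × x ≢ a
  ∈-∖⁻ xs = ∈-filter⁻ (λ x → ¬? (x ≟ _)) {xs = xs}

  ∖-unique : ∀ {a xs} → Unique xs → Unique (xs ∖ a)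
  ∖-unique = Unique.filter⁺ (λ x → ¬? (x ≟ _))

  length-∖ : ∀ {a} xs → Unique xs → a ∈ xs → suc (length (xs ∖ a)) ≡ length xs
  length-∖ {a} (a ∷ xs) (a∉ ∷ _) (here refl) = cong (suc ∘ length) (begin
    (a ∷ xs) ∖ a ≡⟨ List.filter-reject (λ x → ¬? (x ≟ a)) (λ a≢a → a≢a refl) ⟩
    xs ∖ a       ≡⟨ List.filter-all (λ x → ¬? (x ≟ a)) (All.map ≢-sym a∉) ⟩
    xs           ∎)
    where open ≡-Reasoning
  length-∖ {a} (x ∷ xs) (x∉ ∷ u) (there a∈xs) =
    trans (cong (suc ∘ length) (List.filter-accept (λ x → ¬? (x ≟ a)) (All.lookup x∉ a∈xs)))
          (cong suc (length-∖ xs u a∈xs))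

module FieldProperties {q : ℕ} (F : FiniteField q) where

  open FiniteField F public using (Carrier; 0≢1)
  open FiniteField F using (isCommutativeRing; inverse; size)

  commutativeRing : CommutativeRing 0ℓ 0ℓ
  commutativeRing = record { isCommutativeRing = isCommutativeRing }

  open CommutativeRing commutativeRing public
    using (_+_; _*_; -_; _-_; 0#; 1#; +-assoc; +-comm; +-identityˡ; +-identityʳ; -‿inverseʳ;
           *-assoc; *-comm; *-identityˡ; *-identityʳ; zeroˡ; zeroʳ; distribʳ; commutativeSemiring)
  open RingProperties (CommutativeRing.ring commutativeRing) public
    using (-‿injective; -0#≈0#; -1*x≈-x; -‿distribˡ-*; x[y-z]≈xy-xz; [y-z]x≈yx-zx;
           +-identityˡ-unique; +-inverseʳ-unique; +-cancelʳ; x∙y⁻¹≈ε⇒x≈y;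
           //-rightDividesˡ; //-rightDividesʳ; \\-leftDividesˡ; ⁻¹-anti-homo‿-)

  infix 4 _≟_
  _≟_ : DecidableEquality Carrier
  _≟_ = inj⇒≟ (↔⇒↣ (↔-sym (⤖⇒↔ size)))

  open Removal _≟_ public

  elements : List Carrier
  elements = tabulate (Bijection.to size)

  elements-unique : Unique elements
  elements-unique = Unique.tabulate⁺ (Bijection.injective size)

  ∈-elements : ∀ x → x ∈ elements
  ∈-elements x with i , fi≡x ← Bijection.strictlySurjective size x =
    subst (_∈ elements) fi≡x (∈-tabulate⁺ i)

  length-elements : length elements ≡ q
  length-elements = List.length-tabulate _

  nonzero : List Carrier
  nonzero = elements ∖ 0#

  ∈-nonzero : ∀ {x} → x ≢ 0# → x ∈ nonzero
  ∈-nonzero {x} = ∈-∖⁺ (∈-elements x)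

  length-nonzero : suc (length nonzero) ≡ q
  length-nonzero = trans (length-∖ elements elements-unique (∈-elements 0#)) length-elements

  1≢0 : 1# ≢ 0#
  1≢0 = 0≢1 ∘ sym

  -1≢0 : - 1# ≢ 0#
  -1≢0 -1≡0 = 1≢0 (-‿injective (trans -1≡0 (sym -0#≈0#)))

  x-y≡0⇒x≡y : ∀ {x y} → x - y ≡ 0# → x ≡ y
  x-y≡0⇒x≡y = x∙y⁻¹≈ε⇒x≈y _ _

  -- 0# ⁻¹ is the junk value 0#.
  _⁻¹ : Carrier → Carrier
  x ⁻¹ with x ≟ 0#
  ... | yes _   = 0#
  ... | no x≢0 = proj₁ (inverse x x≢0)

  x*x⁻¹≡1 : ∀ {x} → x ≢ 0# → x * x ⁻¹ ≡ 1#
  x*x⁻¹≡1 {x} x≢0 with x ≟ 0#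
  ... | yes x≡0 = contradiction x≡0 x≢0
  ... | no x≢0  = proj₂ (inverse x x≢0)

  infixl 7 _/_
  _/_ : Carrier → Carrier → Carrier
  x / y = x * y ⁻¹

  y*[x/y]≡x : ∀ {x y} → y ≢ 0# → y * (x / y) ≡ x
  y*[x/y]≡x {x} {y} y≢0 = begin
    y * (x * y ⁻¹) ≡⟨ trans (sym (*-assoc y x _)) (cong (_* y ⁻¹) (*-comm y x)) ⟩
    x * y * y ⁻¹   ≡⟨ *-assoc x y _ ⟩
    x * (y * y ⁻¹) ≡⟨ cong (x *_) (x*x⁻¹≡1 y≢0) ⟩
    x * 1#         ≡⟨ *-identityʳ x ⟩
    x              ∎
    where open ≡-Reasoning

  x/y*y≡x : ∀ {x y} → y ≢ 0# → x / y * y ≡ x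
  x/y*y≡x {x} {y} y≢0 = trans (*-comm _ y) (y*[x/y]≡x y≢0)

  *-cancelˡ : ∀ {z x y} → z ≢ 0# → z * x ≡ z * y → x ≡ y
  *-cancelˡ {z} {x} {y} z≢0 zx≡zy = begin
    x              ≡⟨ z⁻¹*[z*w]≡w x ⟨
    z ⁻¹ * (z * x) ≡⟨ cong (z ⁻¹ *_) zx≡zy ⟩
    z ⁻¹ * (z * y) ≡⟨ z⁻¹*[z*w]≡w y ⟩
    y              ∎
    where
    open ≡-Reasoning
    z⁻¹*[z*w]≡w : ∀ w → z ⁻¹ * (z * w) ≡ w
    z⁻¹*[z*w]≡w w = trans (sym (*-assoc _ z w))
      (trans (cong (_* w) (trans (*-comm _ z) (x*x⁻¹≡1 z≢0))) (*-identityˡ w))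

  *-cancelʳ : ∀ {z x y} → z ≢ 0# → x * z ≡ y * z → x ≡ y
  *-cancelʳ {z} {x} {y} z≢0 xz≡yz = *-cancelˡ z≢0 (trans (*-comm z x) (trans xz≡yz (*-comm y z)))

  x+y*0≡x : ∀ x y → x + y * 0# ≡ x
  x+y*0≡x x y = trans (cong (x +_) (zeroʳ y)) (+-identityʳ x)

  1+[x-1]≡x : ∀ x → 1# + (x - 1#) ≡ x
  1+[x-1]≡x x = trans (+-comm 1# _) (//-rightDividesˡ 1# x)

  y+[x-1]*y≡x*y : ∀ x y → y + (x - 1#) * y ≡ x * y
  y+[x-1]*y≡x*y x y = begin
    y + (x - 1#) * y      ≡⟨ cong (y +_) ([y-z]x≈yx-zx y x 1#) ⟩
    y + (x * y - 1# * y)  ≡⟨ cong (λ t → y + (x * y - t)) (*-identityˡ y) ⟩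
    y + (x * y - y)       ≡⟨ cong (y +_) (+-comm (x * y) (- y)) ⟩
    y + (- y + x * y)     ≡⟨ \\-leftDividesˡ y (x * y) ⟩
    x * y                 ∎
    where open ≡-Reasoning

  [1+x]*y≡y+x*y : ∀ x y → (1# + x) * y ≡ y + x * y
  [1+x]*y≡y+x*y x y = trans (distribʳ y 1# x) (cong (_+ x * y) (*-identityˡ y))

  1+x≢0 : ∀ {x} → x ≢ - 1# → 1# + x ≢ 0#
  1+x≢0 {x} x≢-1 = x≢-1 ∘ +-inverseʳ-unique 1# x

  1-y≢0 : ∀ {y} → y ≢ 1# → 1# - y ≢ 0#
  1-y≢0 y≢1 = y≢1 ∘ sym ∘ x-y≡0⇒x≡y

  x+x≡[1+1]*x : ∀ x → x + x ≡ (1# + 1#) * x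
  x+x≡[1+1]*x x = sym (trans (distribʳ x 1# 1#) (cong₂ _+_ (*-identityˡ x) (*-identityˡ x)))

module AffinePlane {q : ℕ} (F : FiniteField q) where

  open FieldProperties F
  open AG2 F public
  open NaturalCoefficientSolver commutativeSemiring using (solve; _:=_; _:+_; _:*_)

  OnLine-scale : ∀ k {a b c p} → OnLine a b c p → OnLine (k * a) (k * b) (k * c) p
  OnLine-scale k {a} {b} {c} {x , y} on = begin
    k * a * x + k * b * y ≡⟨ solve 5 (λ k a b x y → k :* a :* x :+ k :* b :* y := k :* (a :* x :+ b :* y))
                                refl k a b x y ⟩
    k * (a * x + b * y)   ≡⟨ cong (k *_) on ⟩
    k * c                 ∎
    where open ≡-Reasoning

  OnLine-rescale : ∀ k {a b c a′ b′ c′ p} → k * a ≡ a′ → k * b ≡ b′ → k * c ≡ c′ →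
                   OnLine a b c p → OnLine a′ b′ c′ p
  OnLine-rescale k refl refl refl = OnLine-scale k

  OnLine-horizontal : ∀ {c x y} → y ≡ c → OnLine 0# 1# c (x , y)
  OnLine-horizontal {x = x} {y} = trans (trans (cong₂ _+_ (zeroˡ x) (*-identityˡ y)) (+-identityˡ y))

  OnLine-horizontal⁻ : ∀ {c x y} → OnLine 0# 1# c (x , y) → y ≡ c
  OnLine-horizontal⁻ {x = x} {y} = trans (sym (trans (cong₂ _+_ (zeroˡ x) (*-identityˡ y)) (+-identityˡ y)))

  OnLine-slanted : ∀ {b c x y} → x + b * y ≡ c → OnLine 1# b c (x , y)
  OnLine-slanted {b} {x = x} {y} = trans (cong (_+ b * y) (*-identityˡ x))

  OnLine-slanted⁻ : ∀ {b c x y} → OnLine 1# b c (x , y) → x + b * y ≡ c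
  OnLine-slanted⁻ {b} {x = x} {y} = trans (sym (cong (_+ b * y) (*-identityˡ x)))

  horizontal-isLine : IsLineEq 0# 1#
  horizontal-isLine = 1≢0 ∘ proj₂

  slanted-isLine : ∀ {b} → IsLineEq 1# b
  slanted-isLine = 1≢0 ∘ proj₁

  -- Every line a X + b Y = c is a nonzero multiple of a line Y = c′ (if a = 0) or X + b′ Y = c′.
  blocking-fromNormalForms : ∀ {B} →
    (∀ c → Σ Point λ p → p ∈ B × OnLine 0# 1# c p) →
    (∀ b c → Σ Point λ p → p ∈ B × OnLine 1# b c p) → Blocking B
  blocking-fromNormalForms horizontal slanted a b c ab with a ≟ 0#
  ... | yes refl =
    let p , p∈B , on = horizontal (c / b)
    in p , p∈B , OnLine-rescale b (zeroʳ b) (*-identityʳ b) (y*[x/y]≡x (λ b≡0 → ab (refl , b≡0))) on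
  ... | no a≢0 =
    let p , p∈B , on = slanted (b / a) (c / a)
    in p , p∈B , OnLine-rescale a (*-identityʳ a) (y*[x/y]≡x a≢0) (y*[x/y]≡x a≢0) on

  Tangent : (Point → Set) → Point → Set
  Tangent S p = Σ Carrier λ a → Σ Carrier λ b → Σ Carrier λ c →
    IsLineEq a b × OnLine a b c p × (∀ {p′} → S p′ → OnLine a b c p′ → p′ ≡ p)

  horizontalTangent : ∀ {S : Point → Set} {x y} → (∀ {x′} → S (x′ , y) → x′ ≡ x) → Tangent S (x , y)
  horizontalTangent {S} {x} {y} onlyX = 0# , 1# , y , horizontal-isLine , OnLine-horizontal refl , only
    where
    only : ∀ {p′} → S p′ → OnLine 0# 1# y p′ → p′ ≡ (x , y)
    only {x′ , y′} s on with refl ← OnLine-horizontal⁻ on = cong (_, y) (onlyX s)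

  slantedTangent : ∀ {S : Point → Set} {b c x y} → x + b * y ≡ c →
    (∀ {x′ y′} → S (x′ , y′) → x′ + b * y′ ≡ c → (x′ , y′) ≡ (x , y)) → Tangent S (x , y)
  slantedTangent {b = b} {c} on only =
    1# , b , c , slanted-isLine , OnLine-slanted on , λ {(_ , _)} s → only s ∘ OnLine-slanted⁻

  tangents⇒minimal : ∀ {B} → Blocking B → (∀ {p} → p ∈ B → Tangent (_∈ B) p) → MinimalBlocking B
  tangents⇒minimal blocking tangent = blocking , λ S S⊆B S-blocking p p∈B →
    let a , b , c , ab , _ , only-p = tangent p∈B
        p′ , p′∈S , on = S-blocking a b c ab
    in subst (_∈ S) (only-p (S⊆B p′ p′∈S) on) p′∈S

module Construction {q : ℕ} (F : FiniteField q) where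

  open FieldProperties F
  open AffinePlane F

  -- (x , 0), (y , y) and (0 , 1) are collinear.
  Aligned : Carrier → Carrier → Set
  Aligned x y = y + x * y ≡ x

  -- The line through (0 , 1) and (y , y) meets Y = 0 in (project y , 0).
  project : Carrier → Carrier
  project y = y / (1# - y)

  Aligned⇒x*[1-y]≡y : ∀ {x y} → Aligned x y → x * (1# - y) ≡ y
  Aligned⇒x*[1-y]≡y {x} {y} aligned = begin
    x * (1# - y)      ≡⟨ x[y-z]≈xy-xz x 1# y ⟩
    x * 1# - x * y    ≡⟨ cong (_- x * y) (trans (*-identityʳ x) (sym aligned)) ⟩
    y + x * y - x * y ≡⟨ //-rightDividesʳ (x * y) y ⟩
    y                 ∎
    where open ≡-Reasoning

  x*[1-y]≡y⇒Aligned : ∀ {x y} → x * (1# - y) ≡ y → Aligned x y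
  x*[1-y]≡y⇒Aligned {x} {y} eq = begin
    y + x * y              ≡⟨ cong (_+ x * y) (trans (sym eq) (x[y-z]≈xy-xz x 1# y)) ⟩
    x * 1# - x * y + x * y ≡⟨ //-rightDividesˡ (x * y) (x * 1#) ⟩
    x * 1#                 ≡⟨ *-identityʳ x ⟩
    x                      ∎
    where open ≡-Reasoning

  Aligned-functional : ∀ {x y y′} → x ≢ - 1# → Aligned x y → Aligned x y′ → y ≡ y′
  Aligned-functional {x} {y} {y′} x≢-1 aligned aligned′ = *-cancelˡ (1+x≢0 x≢-1) (begin
    (1# + x) * y  ≡⟨ trans ([1+x]*y≡y+x*y x y) aligned ⟩
    x             ≡⟨ trans ([1+x]*y≡y+x*y x y′) aligned′ ⟨
    (1# + x) * y′ ∎)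
    where open ≡-Reasoning

  Aligned-injective : ∀ {x x′ y} → y ≢ 1# → Aligned x y → Aligned x′ y → x ≡ x′
  Aligned-injective y≢1 aligned aligned′ =
    *-cancelʳ (1-y≢0 y≢1) (trans (Aligned⇒x*[1-y]≡y aligned) (sym (Aligned⇒x*[1-y]≡y aligned′)))

  Aligned-0ˡ : ∀ {y} → Aligned 0# y → y ≡ 0#
  Aligned-0ˡ {y} aligned = trans (sym (trans (cong (y +_) (zeroˡ y)) (+-identityʳ y))) aligned

  Aligned-0ʳ : ∀ {x} → Aligned x 0# → x ≡ 0#
  Aligned-0ʳ {x} aligned = trans (sym aligned) (trans (+-identityˡ _) (zeroʳ x))

  ¬Aligned-[-1] : ∀ {y} → ¬ Aligned (- 1#) y
  ¬Aligned-[-1] {y} aligned = -1≢0 (trans (sym aligned) (trans (cong (y +_) (-1*x≈-x y)) (-‿inverseʳ y)))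

  ¬Aligned-1 : ∀ {x} → ¬ Aligned x 1#
  ¬Aligned-1 {x} aligned = 1≢0 (+-identityˡ-unique 1# x (trans (cong (1# +_) (sym (*-identityʳ x))) aligned))

  Aligned-project : ∀ {y} → y ≢ 1# → Aligned (project y) y
  Aligned-project y≢1 = x*[1-y]≡y⇒Aligned (x/y*y≡x (1-y≢0 y≢1))

  ∃-Aligned : ∀ {x} → x ≢ - 1# → ∃ (Aligned x)
  ∃-Aligned {x} x≢-1 = x / (1# + x) , trans (sym ([1+x]*y≡y+x*y x _)) (y*[x/y]≡x (1+x≢0 x≢-1))

  project≢0 : ∀ {y} → y ≢ 0# → y ≢ 1# → project y ≢ 0#
  project≢0 y≢0 y≢1 project≡0 = y≢0 (Aligned-0ˡ (subst (λ x → Aligned x _) project≡0 (Aligned-project y≢1)))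

  project≢-1 : ∀ {y} → y ≢ 1# → project y ≢ - 1#
  project≢-1 y≢1 project≡-1 = ¬Aligned-[-1] (subst (λ x → Aligned x _) project≡-1 (Aligned-project y≢1))

  project-injective : ∀ {y y′} → y ≢ 1# → y′ ≢ 1# → project y ≡ project y′ → y ≡ y′
  project-injective y≢1 y′≢1 eq =
    Aligned-functional (project≢-1 y≢1) (Aligned-project y≢1)
      (subst (λ x → Aligned x _) (sym eq) (Aligned-project y′≢1))

  pivot-equation : ∀ {x ys y} → Aligned x ys → (x - 1#) * y ≡ x → (ys + ys - 1#) * y ≡ ys
  pivot-equation {x} {ys} {y} aligned eq = begin
    (ys + ys - 1#) * y              ≡⟨ cong (_* y) slope ⟨
    (x - 1#) * (1# - ys) * y        ≡⟨ solve 3 (λ a u y → a :* u :* y := u :* (a :* y)) refl (x - 1#) (1# - ys) y ⟩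
    (1# - ys) * ((x - 1#) * y)      ≡⟨ cong ((1# - ys) *_) eq ⟩
    (1# - ys) * x                   ≡⟨ trans (*-comm _ x) (Aligned⇒x*[1-y]≡y aligned) ⟩
    ys                              ∎
    where
    open ≡-Reasoning
    open NaturalCoefficientSolver commutativeSemiring using (solve; _:=_; _:*_)
    slope : (x - 1#) * (1# - ys) ≡ ys + ys - 1#
    slope = begin
      (x - 1#) * (1# - ys)            ≡⟨ [y-z]x≈yx-zx (1# - ys) x 1# ⟩
      x * (1# - ys) - 1# * (1# - ys)  ≡⟨ cong₂ _-_ (Aligned⇒x*[1-y]≡y aligned) (*-identityˡ _) ⟩
      ys - (1# - ys)                  ≡⟨ cong (ys +_) (⁻¹-anti-homo‿- 1# ys) ⟩
      ys + (ys - 1#)                  ≡⟨ +-assoc ys ys (- 1#) ⟨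
      ys + ys - 1#                    ∎

  -- By pivot-equation, the line through (1 , 1) and (project ys , 0) then meets X = 0 at most in (0 , ys).
  Pivot : Carrier → Set
  Pivot ys = ∀ y → (ys + ys - 1#) * y ≡ ys → y ≡ ys

  -- The rows Y = y with y ∉ {0, 1} are split into Y₀, blocked at (0 , y), and Y₁, blocked at (y , y).
  record RowSplit : Set where
    field
      Y₀ Y₁       : List Carrier
      Y₀-unique   : Unique Y₀
      Y₁-unique   : Unique Y₁
      Y₀∪Y₁       : ∀ {y} → y ≢ 0# → y ≢ 1# → y ∈ Y₀ ⊎ y ∈ Y₁
      Y₀∩Y₁       : ∀ {y} → y ∈ Y₀ → y ∉ Y₁
      Y₀⊆         : ∀ {y} → y ∈ Y₀ → y ≢ 0# × y ≢ 1#
      Y₁⊆         : ∀ {y} → y ∈ Y₁ → y ≢ 0# × y ≢ 1#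
      Y₀-nonempty : ∃ (_∈ Y₀)
      Y₁-pivot    : (∀ {y} → y ∉ Y₁) ⊎ ∃ λ ys → ys ∈ Y₁ × Pivot ys

  module BlockingSet (S : RowSplit) where

    open RowSplit S

    data InB : Point → Set where
      minusOne  : InB (- 1# , 0#)
      projected : ∀ {y} → y ∈ Y₀ → InB (project y , 0#)
      top       : ∀ {x} → x ≢ 0# → InB (x , 1#)
      axis      : ∀ {y} → y ∈ Y₀ → InB (0# , y)
      diagonal  : ∀ {y} → y ∈ Y₁ → InB (y , y)

    bottomRow topRow axisPoints diagonalPoints B : List Point
    bottomRow      = (- 1# , 0#) ∷ map (λ y → project y , 0#) Y₀
    topRow         = map (_, 1#) nonzero
    axisPoints     = map (0# ,_) Y₀
    diagonalPoints = map (λ y → y , y) Y₁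
    B              = bottomRow ++ topRow ++ axisPoints ++ diagonalPoints

    InB⇒∈B : ∀ {p} → InB p → p ∈ B
    InB⇒∈B minusOne            = here refl
    InB⇒∈B (projected y∈Y₀)    = there (∈-++⁺ˡ (∈-map⁺ _ y∈Y₀))
    InB⇒∈B (top x≢0)           = ∈-++⁺ʳ bottomRow (∈-++⁺ˡ (∈-map⁺ _ (∈-nonzero x≢0)))
    InB⇒∈B (axis y∈Y₀)         = ∈-++⁺ʳ bottomRow (∈-++⁺ʳ topRow (∈-++⁺ˡ (∈-map⁺ _ y∈Y₀)))
    InB⇒∈B (diagonal y∈Y₁)     = ∈-++⁺ʳ bottomRow (∈-++⁺ʳ topRow (∈-++⁺ʳ axisPoints (∈-map⁺ _ y∈Y₁)))

    ∈B⇒InB : ∀ {p} → p ∈ B → InB p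
    ∈B⇒InB (here refl) = minusOne
    ∈B⇒InB (there p∈B) with ∈-++⁻ (map (λ y → project y , 0#) Y₀) p∈B
    ... | inj₁ p∈ with _ , y∈Y₀ , refl ← ∈-map⁻ _ p∈ = projected y∈Y₀
    ... | inj₂ p∈ with ∈-++⁻ topRow p∈
    ... | inj₁ p∈topRow with _ , x∈ , refl ← ∈-map⁻ _ p∈topRow = top (proj₂ (∈-∖⁻ elements x∈))
    ... | inj₂ p∈ with ∈-++⁻ axisPoints p∈
    ... | inj₁ p∈axis with _ , y∈Y₀ , refl ← ∈-map⁻ _ p∈axis = axis y∈Y₀
    ... | inj₂ p∈diagonal with _ , y∈Y₁ , refl ← ∈-map⁻ _ p∈diagonal = diagonal y∈Y₁

    pointOnRow : ∀ y → ∃ λ x → InB (x , y)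
    pointOnRow y with y ≟ 0# | y ≟ 1#
    ... | yes refl | _        = - 1# , minusOne
    ... | no _     | yes refl = 1# , top 1≢0
    ... | no y≢0   | no y≢1   with Y₀∪Y₁ y≢0 y≢1
    ...   | inj₁ y∈Y₀ = 0# , axis y∈Y₀
    ...   | inj₂ y∈Y₁ = y , diagonal y∈Y₁

    -- X + c Y = c is the line through (0 , 1) and (c , 0).
    pointOnRay : ∀ c → Σ Point λ p → InB p × OnLine 1# c c p
    pointOnRay c with c ≟ - 1#
    ... | yes refl = (- 1# , 0#) , minusOne , OnLine-slanted (x+y*0≡x _ _)
    ... | no c≢-1 with ∃-Aligned c≢-1
    ...   | y , aligned with y ≟ 0#
    ...     | yes refl with refl ← Aligned-0ʳ aligned =
      let y₀ , y₀∈Y₀ = Y₀-nonempty in (0# , y₀) , axis y₀∈Y₀ , OnLine-slanted (trans (+-identityˡ _) (zeroˡ y₀))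
    ...     | no y≢0 with Y₀∪Y₁ y≢0 (λ { refl → ¬Aligned-1 aligned })
    ...       | inj₂ y∈Y₁ = (y , y) , diagonal y∈Y₁ , OnLine-slanted aligned
    ...       | inj₁ y∈Y₀ = (project y , 0#) , projected y∈Y₀ ,
                            OnLine-slanted (trans (x+y*0≡x _ _) (Aligned-injective y≢1 (Aligned-project y≢1) aligned))
      where
      y≢1 : y ≢ 1#
      y≢1 = proj₂ (Y₀⊆ y∈Y₀)

    pointOnSlanted : ∀ b c → Σ Point λ p → InB p × OnLine 1# b c p
    pointOnSlanted b c with c - b ≟ 0#
    ... | yes c-b≡0 with refl ← x-y≡0⇒x≡y c-b≡0 = pointOnRay c
    ... | no c-b≢0 = (c - b , 1#) , top c-b≢0 ,
                     OnLine-slanted (trans (cong (c - b +_) (*-identityʳ b)) (//-rightDividesˡ b c))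

    blocking : Blocking B
    blocking = blocking-fromNormalForms horizontal slanted
      where
      horizontal : ∀ c → Σ Point λ p → p ∈ B × OnLine 0# 1# c p
      horizontal c = let x , x,c∈B = pointOnRow c in (x , c) , InB⇒∈B x,c∈B , OnLine-horizontal refl
      slanted : ∀ b c → Σ Point λ p → p ∈ B × OnLine 1# b c p
      slanted b c = let p , p∈B , on = pointOnSlanted b c in p , InB⇒∈B p∈B , on

    InB-axisRow : ∀ {x y} → InB (x , y) → y ∈ Y₀ → x ≡ 0#
    InB-axisRow minusOne          0∈Y₀ = contradiction refl (proj₁ (Y₀⊆ 0∈Y₀))
    InB-axisRow (projected _)     0∈Y₀ = contradiction refl (proj₁ (Y₀⊆ 0∈Y₀))
    InB-axisRow (top _)           1∈Y₀ = contradiction refl (proj₂ (Y₀⊆ 1∈Y₀))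
    InB-axisRow (axis _)          _    = refl
    InB-axisRow (diagonal y∈Y₁)   y∈Y₀ = contradiction y∈Y₁ (Y₀∩Y₁ y∈Y₀)

    InB-diagonalRow : ∀ {x y} → InB (x , y) → y ∈ Y₁ → x ≡ y
    InB-diagonalRow minusOne        0∈Y₁ = contradiction refl (proj₁ (Y₁⊆ 0∈Y₁))
    InB-diagonalRow (projected _)   0∈Y₁ = contradiction refl (proj₁ (Y₁⊆ 0∈Y₁))
    InB-diagonalRow (top _)         1∈Y₁ = contradiction refl (proj₂ (Y₁⊆ 1∈Y₁))
    InB-diagonalRow (axis y∈Y₀)     y∈Y₁ = contradiction y∈Y₁ (Y₀∩Y₁ y∈Y₀)
    InB-diagonalRow (diagonal _)    _    = refl

    -- The line X + x Y = x through (0 , 1) and (x , 0).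
    tangent-bottom : ∀ {x} → x ≢ 0# → (∀ {y} → y ∈ Y₁ → ¬ Aligned x y) → Tangent InB (x , 0#)
    tangent-bottom {x} x≢0 notAligned = slantedTangent (x+y*0≡x x x) only
      where
      only : ∀ {x′ y′} → InB (x′ , y′) → x′ + x * y′ ≡ x → (x′ , y′) ≡ (x , 0#)
      only minusOne        eq = cong (_, 0#) (trans (sym (x+y*0≡x _ x)) eq)
      only (projected _)   eq = cong (_, 0#) (trans (sym (x+y*0≡x _ x)) eq)
      only (top x′≢0)      eq = contradiction (+-identityˡ-unique _ x (trans (cong (_ +_) (sym (*-identityʳ x))) eq)) x′≢0
      only (axis y∈Y₀)     eq = contradiction (*-cancelˡ x≢0 (trans (trans (sym (+-identityˡ _)) eq) (sym (*-identityʳ x))))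
                                              (proj₂ (Y₀⊆ y∈Y₀))
      only (diagonal y∈Y₁) eq = contradiction eq (notAligned y∈Y₁)

    -- The line X = x Y through (0 , 0) and (x , 1).
    tangent-top : ∀ {x} → x ≢ 0# → (∀ {y} → y ∈ Y₁ → y ≢ x * y) → Tangent InB (x , 1#)
    tangent-top {x} x≢0 offDiagonal =
      slantedTangent (trans (cong (x +_) (*-identityʳ (- x))) (-‿inverseʳ x)) (λ p∈B → only p∈B ∘ throughOrigin)
      where
      throughOrigin : ∀ {x′ y′} → x′ + - x * y′ ≡ 0# → x′ ≡ x * y′
      throughOrigin {x′} {y′} = x-y≡0⇒x≡y ∘ trans (cong (x′ +_) (-‿distribˡ-* x y′))
      only : ∀ {x′ y′} → InB (x′ , y′) → x′ ≡ x * y′ → (x′ , y′) ≡ (x , 1#)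
      only minusOne          eq = contradiction (trans eq (zeroʳ x)) -1≢0
      only (projected y∈Y₀)  eq = contradiction (trans eq (zeroʳ x)) (project≢0 (proj₁ (Y₀⊆ y∈Y₀)) (proj₂ (Y₀⊆ y∈Y₀)))
      only (top _)           eq = cong (_, 1#) (trans eq (*-identityʳ x))
      only (axis y∈Y₀)       eq = contradiction (*-cancelˡ x≢0 (trans (sym eq) (sym (zeroʳ x)))) (proj₁ (Y₀⊆ y∈Y₀))
      only (diagonal y∈Y₁)   eq = contradiction eq (offDiagonal y∈Y₁)

    -- The line X + (project ys - 1) Y = project ys through (1 , 1) and (project ys , 0).
    tangent-pivot : ∀ {ys} → ys ∈ Y₁ → Pivot ys → Tangent InB (1# , 1#)
    tangent-pivot {ys} ys∈Y₁ pivot = slantedTangent (trans (cong (1# +_) (*-identityʳ _)) (1+[x-1]≡x xs)) only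
      where
      ys≢1 : ys ≢ 1#
      ys≢1 = proj₂ (Y₁⊆ ys∈Y₁)
      xs : Carrier
      xs = project ys
      ys∉Y₀ : ys ∉ Y₀
      ys∉Y₀ ys∈Y₀ = Y₀∩Y₁ ys∈Y₀ ys∈Y₁
      only : ∀ {x′ y′} → InB (x′ , y′) → x′ + (xs - 1#) * y′ ≡ xs → (x′ , y′) ≡ (1# , 1#)
      only minusOne eq = contradiction (sym (trans (sym (x+y*0≡x _ _)) eq)) (project≢-1 ys≢1)
      only (projected y∈Y₀) eq =
        contradiction (subst (_∈ Y₀) (project-injective (proj₂ (Y₀⊆ y∈Y₀)) ys≢1 (trans (sym (x+y*0≡x _ _)) eq)) y∈Y₀) ys∉Y₀
      only (top _) eq = cong (_, 1#) (+-cancelʳ (xs - 1#) _ 1#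
        (trans (trans (cong (_ +_) (sym (*-identityʳ _))) eq) (sym (1+[x-1]≡x xs))))
      only (axis {y} y∈Y₀) eq = contradiction
        (subst (_∈ Y₀) (pivot y (pivot-equation (Aligned-project ys≢1) (trans (sym (+-identityˡ _)) eq))) y∈Y₀) ys∉Y₀
      only (diagonal {y} y∈Y₁) eq = contradiction
        (*-cancelˡ (project≢0 (proj₁ (Y₁⊆ ys∈Y₁)) ys≢1) (trans (sym (y+[x-1]*y≡x*y xs y)) (trans eq (sym (*-identityʳ xs)))))
        (proj₂ (Y₁⊆ y∈Y₁))

    tangent : ∀ {p} → InB p → Tangent InB p
    tangent minusOne = tangent-bottom -1≢0 (λ _ → ¬Aligned-[-1])
    tangent (projected {y} y∈Y₀) = tangent-bottom (project≢0 y≢0 y≢1) notAligned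
      where
      y≢0 : y ≢ 0#
      y≢0 = proj₁ (Y₀⊆ y∈Y₀)
      y≢1 : y ≢ 1#
      y≢1 = proj₂ (Y₀⊆ y∈Y₀)
      notAligned : ∀ {y′} → y′ ∈ Y₁ → ¬ Aligned (project y) y′
      notAligned y′∈Y₁ aligned′ =
        Y₀∩Y₁ (subst (_∈ Y₀) (Aligned-functional (project≢-1 y≢1) (Aligned-project y≢1) aligned′) y∈Y₀) y′∈Y₁
    tangent (axis y∈Y₀)     = horizontalTangent (λ p∈B → InB-axisRow p∈B y∈Y₀)
    tangent (diagonal y∈Y₁) = horizontalTangent (λ p∈B → InB-diagonalRow p∈B y∈Y₁)
    tangent (top {x} x≢0) with x ≟ 1# | Y₁-pivot
    ... | no x≢1    | _                          = tangent-top x≢0 offDiagonal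
      where
      offDiagonal : ∀ {y} → y ∈ Y₁ → y ≢ x * y
      offDiagonal y∈Y₁ y≡xy = x≢1 (sym (*-cancelʳ (proj₁ (Y₁⊆ y∈Y₁)) (trans (*-identityˡ _) y≡xy)))
    ... | yes refl  | inj₁ Y₁≡∅                  = tangent-top x≢0 (λ y∈Y₁ → contradiction y∈Y₁ Y₁≡∅)
    ... | yes refl  | inj₂ (_ , ys∈Y₁ , pivot)   = tangent-pivot ys∈Y₁ pivot

    minimal : MinimalBlocking B
    minimal = tangents⇒minimal blocking λ p∈B →
      let a , b , c , ab , on , only = tangent (∈B⇒InB p∈B) in a , b , c , ab , on , only ∘ ∈B⇒InB

    onBottomRow : ∀ {p} → p ∈ bottomRow → proj₂ p ≡ 0#
    onBottomRow (here refl) = refl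
    onBottomRow (there p∈) with _ , _ , refl ← ∈-map⁻ _ p∈ = refl

    onTopRow : ∀ {p} → p ∈ topRow → proj₂ p ≡ 1#
    onTopRow p∈ with _ , _ , refl ← ∈-map⁻ _ p∈ = refl

    offBottomAndTopRow : ∀ {p} → p ∈ axisPoints ++ diagonalPoints → proj₂ p ≢ 0# × proj₂ p ≢ 1#
    offBottomAndTopRow p∈ with ∈-++⁻ axisPoints p∈
    ... | inj₁ p∈axis     with _ , y∈Y₀ , refl ← ∈-map⁻ _ p∈axis     = Y₀⊆ y∈Y₀
    ... | inj₂ p∈diagonal with _ , y∈Y₁ , refl ← ∈-map⁻ _ p∈diagonal = Y₁⊆ y∈Y₁

    bottomRow-unique : Unique bottomRow
    bottomRow-unique =
      All.map⁺ (All.tabulate (λ y∈Y₀ e → project≢-1 (proj₂ (Y₀⊆ y∈Y₀)) (cong proj₁ (sym e)))) ∷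
      map⁺-injectiveOn (λ y≢1 y′≢1 → project-injective y≢1 y′≢1 ∘ cong proj₁) (All.tabulate (proj₂ ∘ Y₀⊆)) Y₀-unique

    B-unique : Unique B
    B-unique =
      Unique.++⁺ bottomRow-unique
        (Unique.++⁺ (Unique.map⁺ (cong proj₁) (∖-unique elements-unique))
          (Unique.++⁺ (Unique.map⁺ (cong proj₂) Y₀-unique) (Unique.map⁺ (cong proj₁) Y₁-unique) axis∩diagonal)
          top∩rest)
        bottom∩rest
      where
      axis∩diagonal : Disjoint axisPoints diagonalPoints
      axis∩diagonal (p∈axis , p∈diagonal)
        with _ , y∈Y₀ , refl ← ∈-map⁻ _ p∈axis
        with _ , y∈Y₁ , refl ← ∈-map⁻ _ p∈diagonal = Y₀∩Y₁ y∈Y₀ y∈Y₁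
      top∩rest : Disjoint topRow (axisPoints ++ diagonalPoints)
      top∩rest (p∈top , p∈rest) = proj₂ (offBottomAndTopRow p∈rest) (onTopRow p∈top)
      bottom∩rest : Disjoint bottomRow (topRow ++ axisPoints ++ diagonalPoints)
      bottom∩rest (p∈bottom , p∈rest) with ∈-++⁻ topRow p∈rest
      ... | inj₁ p∈top  = 1≢0 (trans (sym (onTopRow p∈top)) (onBottomRow p∈bottom))
      ... | inj₂ p∈rest′ = proj₁ (offBottomAndTopRow p∈rest′) (onBottomRow p∈bottom)

    length-B : length B ≡ suc (length Y₀) ℕ.+ (length nonzero ℕ.+ (length Y₀ ℕ.+ length Y₁))
    length-B = trans (List.length-++ bottomRow)
      (cong₂ ℕ._+_ (cong suc (List.length-map _ Y₀))
        (trans (List.length-++ topRow) (cong₂ ℕ._+_ (List.length-map _ nonzero)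
          (trans (List.length-++ axisPoints) (cong₂ ℕ._+_ (List.length-map _ Y₀) (List.length-map _ Y₁))))))

  nonTrivial : List Carrier
  nonTrivial = nonzero ∖ 1#

  ∈-nonTrivial : ∀ {y} → y ≢ 0# → y ≢ 1# → y ∈ nonTrivial
  ∈-nonTrivial y≢0 y≢1 = ∈-∖⁺ (∈-nonzero y≢0) y≢1

  ∈-nonTrivial⁻ : ∀ {y} → y ∈ nonTrivial → y ≢ 0# × y ≢ 1#
  ∈-nonTrivial⁻ y∈ = let y∈nonzero , y≢1 = ∈-∖⁻ nonzero y∈ in proj₂ (∈-∖⁻ elements y∈nonzero) , y≢1

  nonTrivial-unique : Unique nonTrivial
  nonTrivial-unique = ∖-unique (∖-unique elements-unique)

  length-nonTrivial : suc (length nonTrivial) ≡ length nonzero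
  length-nonTrivial = length-∖ nonzero (∖-unique elements-unique) (∈-nonzero 1≢0)

  nonTrivial-nonempty : 3 ≤ q → ∃ (_∈ nonTrivial)
  nonTrivial-nonempty 3≤q = ∃∈-nonempty nonTrivial
    (ℕ.≤-pred (ℕ.≤-pred (subst (3 ≤_) (sym (trans (cong suc length-nonTrivial) length-nonzero)) 3≤q)))

  -- In characteristic 2 every ys ∉ {0, 1} is a pivot; otherwise 1/2 is.
  ∃-pivot : 3 ≤ q → ∃ λ ys → (ys ≢ 0# × ys ≢ 1#) × Pivot ys
  ∃-pivot 3≤q with 1# + 1# ≟ 0#
  ... | yes 2≡0 with ys , ys∈ ← nonTrivial-nonempty 3≤q = ys , ∈-nonTrivial⁻ ys∈ , pivot
    where
    x+x≡0 : ∀ x → x + x ≡ 0#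
    x+x≡0 x = trans (x+x≡[1+1]*x x) (trans (cong (_* x) 2≡0) (zeroˡ x))
    pivot : Pivot ys
    pivot y eq = begin
      y                  ≡⟨ +-inverseʳ-unique y y (x+x≡0 y) ⟩
      - y                ≡⟨ -1*x≈-x y ⟨
      - 1# * y           ≡⟨ cong (_* y) (+-identityˡ (- 1#)) ⟨
      (0# - 1#) * y      ≡⟨ cong (λ t → (t - 1#) * y) (x+x≡0 ys) ⟨
      (ys + ys - 1#) * y ≡⟨ eq ⟩
      ys                 ∎
      where open ≡-Reasoning
  ... | no 2≢0 = half , (half≢0 , half≢1) , pivot
    where
    half : Carrier
    half = 1# / (1# + 1#)
    half+half≡1 : half + half ≡ 1#
    half+half≡1 = trans (x+x≡[1+1]*x half) (y*[x/y]≡x 2≢0)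
    half≢0 : half ≢ 0#
    half≢0 half≡0 = 1≢0 (trans (sym half+half≡1) (trans (cong₂ _+_ half≡0 half≡0) (+-identityˡ 0#)))
    half≢1 : half ≢ 1#
    half≢1 half≡1 = 1≢0 (+-identityˡ-unique 1# 1# (trans (cong₂ _+_ (sym half≡1) (sym half≡1)) half+half≡1))
    pivot : Pivot half
    pivot y eq = contradiction (trans (sym eq) (trans (cong (λ t → (t - 1#) * y) half+half≡1)
                                                      (trans (cong (_* y) (-‿inverseʳ 1#)) (zeroˡ y)))) half≢0

  -- Listing the pivot first puts it into Y₁ = take m rows whenever m > 0.
  module PivotFirst {ys} (ys≢0 : ys ≢ 0#) (ys≢1 : ys ≢ 1#) (pivot : Pivot ys) where

    rows : List Carrier
    rows = ys ∷ nonTrivial ∖ ys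

    rows-unique : Unique rows
    rows-unique = All.tabulate (≢-sym ∘ proj₂ ∘ ∈-∖⁻ nonTrivial) ∷ ∖-unique nonTrivial-unique

    ∈-rows : ∀ {y} → y ≢ 0# → y ≢ 1# → y ∈ rows
    ∈-rows {y} y≢0 y≢1 with y ≟ ys
    ... | yes refl = here refl
    ... | no y≢ys  = there (∈-∖⁺ (∈-nonTrivial y≢0 y≢1) y≢ys)

    ∈-rows⁻ : ∀ {y} → y ∈ rows → y ≢ 0# × y ≢ 1#
    ∈-rows⁻ (here refl) = ys≢0 , ys≢1
    ∈-rows⁻ (there y∈)  = ∈-nonTrivial⁻ (proj₁ (∈-∖⁻ nonTrivial y∈))

    length-rows : length rows ≡ length nonTrivial
    length-rows = length-∖ nonTrivial nonTrivial-unique (∈-nonTrivial ys≢0 ys≢1)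

    take-pivot : ∀ m → (∀ {y} → y ∉ take m rows) ⊎ ∃ λ ys′ → ys′ ∈ take m rows × Pivot ys′
    take-pivot zero    = inj₁ λ ()
    take-pivot (suc m) = inj₂ (ys , here refl , pivot)

    rowSplit : ∀ m → m < length rows → RowSplit
    rowSplit m m<length = record
      { Y₀          = drop m rows
      ; Y₁          = take m rows
      ; Y₀-unique   = Unique.drop⁺ m rows-unique
      ; Y₁-unique   = Unique.take⁺ m rows-unique
      ; Y₀∪Y₁       = λ y≢0 y≢1 → swap (∈-++⁻ (take m rows) (subst (_ ∈_) (sym take++drop) (∈-rows y≢0 y≢1)))
      ; Y₀∩Y₁       = λ y∈Y₀ y∈Y₁ → Unique-++⇒Disjoint (take m rows) (subst Unique (sym take++drop) rows-unique) (y∈Y₁ , y∈Y₀)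
      ; Y₀⊆         = ∈-rows⁻ ∘ subst (_ ∈_) take++drop ∘ ∈-++⁺ʳ (take m rows)
      ; Y₁⊆         = ∈-rows⁻ ∘ subst (_ ∈_) take++drop ∘ ∈-++⁺ˡ
      ; Y₀-nonempty = ∃∈-nonempty (drop m rows) (subst (0 <_) (sym (List.length-drop m rows)) (ℕ.m<n⇒0<n∸m m<length))
      ; Y₁-pivot    = take-pivot m
      }
      where
      take++drop : take m rows ++ drop m rows ≡ rows
      take++drop = List.take++drop≡id m rows

  minimalBlockingSet : 3 ≤ q → ∀ s → 0 < s → s ≤ length nonTrivial →
    Σ (List Point) λ B → Unique B × length B ≡ suc s ℕ.+ (suc (length nonTrivial) ℕ.+ length nonTrivial) × MinimalBlocking B
  minimalBlockingSet 3≤q s 0<s s≤r with ys , (ys≢0 , ys≢1) , pivot ← ∃-pivot 3≤q =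
    B , B-unique , size , minimal
    where
    open PivotFirst ys≢0 ys≢1 pivot
    s≤length : s ≤ length rows
    s≤length = subst (s ≤_) (sym length-rows) s≤r
    m : ℕ
    m = length rows ∸ s
    split : RowSplit
    split = rowSplit m (ℕ.∸-monoʳ-< 0<s s≤length)
    open BlockingSet split
    open RowSplit split using (Y₀; Y₁)
    |Y₀|≡s : length Y₀ ≡ s
    |Y₀|≡s = trans (List.length-drop m rows) (ℕ.m∸[m∸n]≡n s≤length)
    |Y₀|+|Y₁|≡r : length Y₀ ℕ.+ length Y₁ ≡ length nonTrivial
    |Y₀|+|Y₁|≡r = trans (ℕ.+-comm (length Y₀) _)
                   (trans (sym (List.length-++ Y₁)) (trans (cong length (List.take++drop≡id m rows)) length-rows))
    size : length B ≡ suc s ℕ.+ (suc (length nonTrivial) ℕ.+ length nonTrivial)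
    size = trans length-B (cong₂ (λ a b → suc a ℕ.+ b) |Y₀|≡s (cong₂ ℕ._+_ (sym length-nonTrivial) |Y₀|+|Y₁|≡r))

open import Data.Nat using (_*_)

sizeDecomposition : ∀ {q r k} → suc (suc r) ≡ q → 2 * q ∸ 1 ≤ k → k ≤ 3 * q ∸ 4 →
  ∃ λ s → 0 < s × s ≤ r × suc s ℕ.+ (suc r ℕ.+ r) ≡ k
sizeDecomposition {r = r} {k} refl lo hi = k ∸ base , ℕ.m<n⇒0<n∸m base<k , s≤r , size
  where
  open +-*-Solver
  base : ℕ
  base = suc (suc r ℕ.+ r)
  base<k : base < k
  base<k = subst (_≤ k) (cong (_∸ 1) (solve 1 (λ r → con 2 :* (con 2 :+ r) := con 1 :+ (con 3 :+ r :+ r)) refl r)) lo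
  s≤r : k ∸ base ≤ r
  s≤r = subst (k ∸ base ≤_) (ℕ.m+n∸m≡n base r)
          (ℕ.∸-monoˡ-≤ base (subst (k ≤_) (cong (_∸ 4) (solve 1 (λ r → con 3 :* (con 2 :+ r) := con 4 :+ (con 2 :+ r :+ r :+ r)) refl r)) hi))
  size : suc (k ∸ base) ℕ.+ (suc r ℕ.+ r) ≡ k
  size = trans (solve 2 (λ s r → con 1 :+ s :+ (con 1 :+ r :+ r) := con 2 :+ r :+ r :+ s) refl (k ∸ base) r)
               (ℕ.m+[n∸m]≡n (ℕ.<⇒≤ base<k))

minimalBlockingSetOfSize : ∀ {q} (F : FiniteField q) → 3 ≤ q → ∀ {k} → 2 * q ∸ 1 ≤ k → k ≤ 3 * q ∸ 4 →
  Σ (List (AG2.Point F)) λ B → Unique B × length B ≡ k × AG2.MinimalBlocking F B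
minimalBlockingSetOfSize F 3≤q lo hi =
  let s , 0<s , s≤r , size≡k = sizeDecomposition (trans (cong suc length-nonTrivial) length-nonzero) lo hi
      B , B-unique , length-B , minimal = minimalBlockingSet 3≤q s 0<s s≤r
  in B , B-unique , trans length-B size≡k , minimal
  where
  open FieldProperties F
  open Construction F

theorem4p6 : (q : ℕ) → 5 ≤ q → IsPrimePower q → ¬ (2 ∣ q) →
    (F : FiniteField q) → (k : ℕ) → 2 * q ∸ 1 ≤ k → k ≤ 3 * q ∸ 4 →
    Σ (List (AG2.Point F)) λ B → Unique B × length B ≡ k × AG2.MinimalBlocking F B
theorem4p6 q 5≤q _ _ F k = minimalBlockingSetOfSize F (ℕ.≤-trans (ℕ.m≤m+n 3 2) 5≤q)
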